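{- Let $k\ge 1$ and use the convention $A_k(j)=0$ for negative integers $j$. Then for every integer $n\ge 0$, $$A_k(2n+1)=\sum_{i\ge0}\left(\binom{k}{4i+2}+\binom{k}{4i}\right)A_k(n-i)=\left(\binom{k}{2}+\binom{k}{0}\right)A_k(n)+\left(\binom{k}{6}+\binom{k}{4}\right)A_k(n-1)+\cdots,$$ $$A_k(2n+2)=\binom{k}{0}A_k(n+1)+\sum_{i\ge0}\left(\binom{k}{4i+2}+\binom{k}{4i+4}\right)A_k(n-i)=\binom{k}{0}A_k(n+1)+\left(\binom{k}{2}+\binom{k}{4}\right)A_k(n)+\left(\binom{k}{6}+\binom{k}{8}\right)A_k(n-1)+\cdots.$$
   Context: A P-position of the game of Nim with $k$ piles is a $k$-tuple $(p_1,\dots,p_k)$ of non-negative integers whose nim-sum $p_1\oplus\cdots\oplus p_k$ is $0$, where $\oplus$ denotes bitwise XOR. $A_k(n)$ denotes the number of P-positions with $k$ piles whose total number of counters is at most $2n$. Binomial coefficients $\binom{k}{m}$ with $m>k$ are $0$. -}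

module Defs where

open import Data.Nat using (ℕ; zero; suc; _+_; _*_; _∸_; _≤ᵇ_; _≡ᵇ_)
open import Data.Nat.DivMod using (_/_; _%_)
open import Data.Bool using (Bool; true; false; _∧_)
open import Data.List using (List; []; _∷_; map; concatMap; filter; length; foldr; upTo)
open import Data.Nat.ListAction using (sum)
open import Data.Vec using (Vec; []; _∷_)
import Data.Vec as Vec

-- Bitwise XOR on ℕ, computed with fuel (fuel ≥ a + b suffices,
-- since each step halves both arguments).
xorFuel : ℕ → ℕ → ℕ → ℕ
xorFuel zero    a b = 0
xorFuel (suc f) a b =
  ((a % 2 + b % 2) % 2) + 2 * xorFuel f (a / 2) (b / 2)

_⊕_ : ℕ → ℕ → ℕ
a ⊕ b = xorFuel (a + b) a b

nimSum : ∀ {k} → Vec ℕ k → ℕ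
nimSum = Vec.foldr _ _⊕_ 0

total : ∀ {k} → Vec ℕ k → ℕ
total = Vec.foldr _ _+_ 0

tuples : (k m : ℕ) → List (Vec ℕ k)
tuples zero    m = [] ∷ []
tuples (suc k) m = concatMap (λ x → map (x ∷_) (tuples k m)) (upTo (suc m))

isP≤ : ∀ {k} → ℕ → Vec ℕ k → Bool
isP≤ t v = (nimSum v ≡ᵇ 0) ∧ (total v ≤ᵇ t)

-- A k n = number of P-positions of k-pile Nim with total ≤ 2n.
-- (Every such tuple has all entries ≤ 2n, so enumerating {0,…,2n}^k is exhaustive.)
A : ℕ → ℕ → ℕ
A k n = length (filter (λ v → isP≤ (2 * n) v Data.Bool.≟ true) (tuples k (2 * n)))

Σ≤ : ℕ → (ℕ → ℕ) → ℕ
Σ≤ n f = sum (map f (upTo (suc n)))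

module Submission where

-- Write every pile as 2q + b with b ∈ {0,1}. Nim-sum and total then split as
-- (w mod 2) + 2·nimSum(q) and w + 2·total(q), where w is the number of odd piles,
-- so the position is a P-position iff w is even and q is one; the C(k,w) choices
-- of the odd piles give the binomial coefficients. A P-position has even total 2u,
-- and w + 4u ≤ w + 4s + r with r < 4 holds iff u ≤ s, so the q that are counted
-- are exactly those counted by A_k(s). For the bound 4n+2 the weights 4i and 4i+2
-- both leave s = n − i; for 4n+4 the weight 0 leaves s = n + 1 and the weights
-- 4i+2 and 4i+4 leave s = n − i.


open import Defs
open import Data.Bool using (Bool; true; false; _∧_)
import Data.Bool as Bool
open import Data.Bool.Properties using (∧-zeroʳ)
open import Data.Nat
open import Data.Nat.Properties
open import Algebra.Properties.CommutativeSemigroup +-commutativeSemigroup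
  using (interchange; xy∙z≈x∙zy)
open import Data.Nat.DivMod
open import Data.Nat.Divisibility using (divides)
open import Data.Nat.Combinatorics using (_C_; nCk+nC[k+1]≡[n+1]C[k+1]; k>n⇒nCk≡0)
open import Data.Nat.Tactic.RingSolver using (solve-∀)
open import Data.List using (List; []; _∷_; _++_; map; concatMap; filter; length; applyUpTo; upTo)
open import Data.Nat.ListAction using (sum)
open import Data.Product using (_×_; _,_)
open import Data.Vec using (Vec; []; _∷_)
open import Function.Bundles using (_⇔_; mk⇔; module Equivalence)
open import Relation.Nullary.Decidable using (does-⇔; dec-false)
open import Relation.Binary.PropositionalEquality

bit : Bool → ℕ
bit false = 0
bit true  = 1

bit≤1 : ∀ c → bit c ≤ 1
bit≤1 false = z≤n
bit≤1 true  = s≤s z≤n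

[2m+c]%2≡c : ∀ m {c} → c ≤ 1 → (2 * m + c) % 2 ≡ c
[2m+c]%2≡c m {c} c≤1 = begin
  (2 * m + c) % 2 ≡⟨ cong (_% 2) (+-comm (2 * m) c) ⟩
  (c + 2 * m) % 2 ≡⟨ cong (λ x → (c + x) % 2) (*-comm 2 m) ⟩
  (c + m * 2) % 2 ≡⟨ [m+kn]%n≡m%n c m 2 ⟩
  c % 2           ≡⟨ m≤n⇒m%n≡m c≤1 ⟩
  c               ∎
  where open ≡-Reasoning

[2m+c]/2≡m : ∀ m {c} → c ≤ 1 → (2 * m + c) / 2 ≡ m
[2m+c]/2≡m m {c} c≤1 = begin
  (2 * m + c) / 2   ≡⟨ cong (_/ 2) (trans (+-comm (2 * m) c) (cong (c +_) (*-comm 2 m))) ⟩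
  (c + m * 2) / 2   ≡⟨ +-distrib-/-∣ʳ c (divides m refl) ⟩
  c / 2 + m * 2 / 2 ≡⟨ cong₂ _+_ (m<n⇒m/n≡0 (s≤s c≤1)) (m*n/n≡m m 2) ⟩
  m                 ∎
  where open ≡-Reasoning

[2m]%2≡0 : ∀ m → (2 * m) % 2 ≡ 0
[2m]%2≡0 m = trans (cong (_% 2) (*-comm 2 m)) (m*n%n≡0 m 2)

m≡2[m/2]+m%2 : ∀ m → m ≡ 2 * (m / 2) + m % 2
m≡2[m/2]+m%2 m = trans (m≡m%n+[m/n]*n m 2)
                       (trans (+-comm (m % 2) _) (cong (_+ m % 2) (*-comm (m / 2) 2)))

xorFuel-0-0 : ∀ f → xorFuel f 0 0 ≡ 0
xorFuel-0-0 zero    = refl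
xorFuel-0-0 (suc f) = cong (2 *_) (xorFuel-0-0 f)

halves-< : ∀ a b {h} → a + b ≤ suc h → a / 2 + b / 2 < suc h
halves-< a b {h} ab≤ = *-cancelʳ-< 2 _ _ (begin-strict
  (a / 2 + b / 2) * 2     ≡⟨ *-distribʳ-+ 2 (a / 2) (b / 2) ⟩
  a / 2 * 2 + b / 2 * 2   ≤⟨ +-mono-≤ (m/n*n≤m a 2) (m/n*n≤m b 2) ⟩
  a + b                   ≤⟨ ab≤ ⟩
  suc h                   <⟨ m<m*n (suc h) 2 (s≤s (s≤s z≤n)) ⟩
  suc h * 2               ∎)
  where open ≤-Reasoning

xorFuel-fuel : ∀ f g {a b} → a + b ≤ f → a + b ≤ g → xorFuel f a b ≡ xorFuel g a b
xorFuel-fuel zero    g {zero}  {zero}  _  _  = sym (xorFuel-0-0 g)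
xorFuel-fuel (suc f) zero {zero} {zero} _ _ = xorFuel-0-0 (suc f)
xorFuel-fuel (suc f) (suc g) {a} {b} ≤f ≤g =
  cong (λ x → (a % 2 + b % 2) % 2 + 2 * x)
       (xorFuel-fuel f g (≤-pred (halves-< a b ≤f)) (≤-pred (halves-< a b ≤g)))

⊕-low-bits : ∀ a b {c d} → c ≤ 1 → d ≤ 1 →
  (2 * a + c) ⊕ (2 * b + d) ≡ (c + d) % 2 + 2 * (a ⊕ b)
⊕-low-bits a b {c} {d} c≤1 d≤1 = begin
  xorFuel (x + y) x y
    ≡⟨ xorFuel-fuel (x + y) (suc (x + y)) ≤-refl (n≤1+n _) ⟩
  (x % 2 + y % 2) % 2 + 2 * xorFuel (x + y) (x / 2) (y / 2)
    ≡⟨ cong₂ (λ u v → (u + v) % 2 + 2 * xorFuel (x + y) (x / 2) (y / 2))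
             ([2m+c]%2≡c a c≤1) ([2m+c]%2≡c b d≤1) ⟩
  (c + d) % 2 + 2 * xorFuel (x + y) (x / 2) (y / 2)
    ≡⟨ cong₂ (λ u v → (c + d) % 2 + 2 * xorFuel (x + y) u v)
             ([2m+c]/2≡m a c≤1) ([2m+c]/2≡m b d≤1) ⟩
  (c + d) % 2 + 2 * xorFuel (x + y) a b
    ≡⟨ cong (λ z → (c + d) % 2 + 2 * z) (xorFuel-fuel (x + y) (a + b) a+b≤ ≤-refl) ⟩
  (c + d) % 2 + 2 * (a ⊕ b) ∎
  where
  open ≡-Reasoning
  x = 2 * a + c
  y = 2 * b + d
  a+b≤ : a + b ≤ x + y
  a+b≤ = +-mono-≤ (≤-trans (m≤m+n a (a + 0)) (m≤m+n (2 * a) c))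
                  (≤-trans (m≤m+n b (b + 0)) (m≤m+n (2 * b) d))

[m+n%d]%d≡[m+n]%d : ∀ m n d .{{_ : NonZero d}} → (m + n % d) % d ≡ (m + n) % d
[m+n%d]%d≡[m+n]%d m n d = begin
  (m + n % d) % d         ≡⟨ %-distribˡ-+ m (n % d) d ⟩
  (m % d + n % d % d) % d ≡⟨ cong (λ z → (m % d + z) % d) (m%n%n≡m%n n d) ⟩
  (m % d + n % d) % d     ≡⟨ %-distribˡ-+ m n d ⟨
  (m + n) % d             ∎
  where open ≡-Reasoning

[a⊕b]%2≡[a+b]%2 : ∀ a b → (a ⊕ b) % 2 ≡ (a + b) % 2
[a⊕b]%2≡[a+b]%2 a b = begin
  (a ⊕ b) % 2
    ≡⟨ cong (_% 2) (cong₂ _⊕_ (m≡2[m/2]+m%2 a) (m≡2[m/2]+m%2 b)) ⟩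
  ((2 * (a / 2) + a % 2) ⊕ (2 * (b / 2) + b % 2)) % 2
    ≡⟨ cong (_% 2) (⊕-low-bits (a / 2) (b / 2) (≤-pred (m%n<n a 2)) (≤-pred (m%n<n b 2))) ⟩
  (p + 2 * h) % 2     ≡⟨ cong (λ z → (p + z) % 2) (*-comm 2 h) ⟩
  (p + h * 2) % 2     ≡⟨ [m+kn]%n≡m%n p h 2 ⟩
  p % 2               ≡⟨ m%n%n≡m%n (a % 2 + b % 2) 2 ⟩
  (a % 2 + b % 2) % 2 ≡⟨ %-distribˡ-+ a b 2 ⟨
  (a + b) % 2         ∎
  where
  open ≡-Reasoning
  p = (a % 2 + b % 2) % 2
  h = (a / 2) ⊕ (b / 2)

nimSum%2≡total%2 : ∀ {k} (v : Vec ℕ k) → nimSum v % 2 ≡ total v % 2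
nimSum%2≡total%2 []      = refl
nimSum%2≡total%2 (x ∷ v) = begin
  (x ⊕ nimSum v) % 2          ≡⟨ [a⊕b]%2≡[a+b]%2 x (nimSum v) ⟩
  (x + nimSum v) % 2          ≡⟨ [m+n%d]%d≡[m+n]%d x (nimSum v) 2 ⟨
  (x + nimSum v % 2) % 2      ≡⟨ cong (λ z → (x + z) % 2) (nimSum%2≡total%2 v) ⟩
  (x + total v % 2) % 2       ≡⟨ [m+n%d]%d≡[m+n]%d x (total v) 2 ⟩
  (x + total v) % 2           ∎
  where open ≡-Reasoning

assemble : ∀ {k} → Vec ℕ k → Vec Bool k → Vec ℕ k
assemble []       []       = []
assemble (q ∷ qs) (c ∷ cs) = (2 * q + bit c) ∷ assemble qs cs

popcount : ∀ {k} → Vec Bool k → ℕ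
popcount []       = 0
popcount (c ∷ cs) = bit c + popcount cs

nimSum-assemble : ∀ {k} (q : Vec ℕ k) (b : Vec Bool k) →
  nimSum (assemble q b) ≡ popcount b % 2 + 2 * nimSum q
nimSum-assemble []       []       = refl
nimSum-assemble (q ∷ qs) (c ∷ cs) = begin
  (2 * q + bit c) ⊕ nimSum (assemble qs cs)
    ≡⟨ cong ((2 * q + bit c) ⊕_) (trans (nimSum-assemble qs cs) (+-comm (w % 2) _)) ⟩
  (2 * q + bit c) ⊕ (2 * nimSum qs + w % 2)
    ≡⟨ ⊕-low-bits q (nimSum qs) (bit≤1 c) (≤-pred (m%n<n w 2)) ⟩
  (bit c + w % 2) % 2 + 2 * (q ⊕ nimSum qs)
    ≡⟨ cong (_+ 2 * (q ⊕ nimSum qs)) ([m+n%d]%d≡[m+n]%d (bit c) w 2) ⟩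
  (bit c + w) % 2 + 2 * (q ⊕ nimSum qs) ∎
  where
  open ≡-Reasoning
  w = popcount cs

total-assemble : ∀ {k} (q : Vec ℕ k) (b : Vec Bool k) →
  total (assemble q b) ≡ popcount b + 2 * total q
total-assemble []       []       = refl
total-assemble (q ∷ qs) (c ∷ cs) = begin
  (2 * q + bit c) + total (assemble qs cs)   ≡⟨ cong ((2 * q + bit c) +_) (total-assemble qs cs) ⟩
  (2 * q + bit c) + (popcount cs + 2 * total qs) ≡⟨ shuffle q (bit c) (popcount cs) (total qs) ⟩
  (bit c + popcount cs) + 2 * (q + total qs) ∎
  where
  open ≡-Reasoning
  shuffle : ∀ a b c d → (2 * a + b) + (c + 2 * d) ≡ (b + c) + 2 * (a + d)
  shuffle = solve-∀

private variable X Y : Set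

sumBy : List X → (X → ℕ) → ℕ
sumBy []       f = 0
sumBy (x ∷ xs) f = f x + sumBy xs f

sumBy-cong : ∀ (xs : List X) {f g : X → ℕ} → (∀ x → f x ≡ g x) → sumBy xs f ≡ sumBy xs g
sumBy-cong []       f≗g = refl
sumBy-cong (x ∷ xs) f≗g = cong₂ _+_ (f≗g x) (sumBy-cong xs f≗g)

sumBy-zero : ∀ (xs : List X) {f : X → ℕ} → (∀ x → f x ≡ 0) → sumBy xs f ≡ 0
sumBy-zero []       f≗0 = refl
sumBy-zero (x ∷ xs) f≗0 = cong₂ _+_ (f≗0 x) (sumBy-zero xs f≗0)

sumBy-+ : ∀ (xs : List X) (f g : X → ℕ) →
  sumBy xs (λ x → f x + g x) ≡ sumBy xs f + sumBy xs g
sumBy-+ []       f g = refl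
sumBy-+ (x ∷ xs) f g = trans (cong (f x + g x +_) (sumBy-+ xs f g))
                             (interchange (f x) (g x) (sumBy xs f) (sumBy xs g))

sumBy-*ˡ : ∀ (xs : List X) c (f : X → ℕ) → sumBy xs (λ x → c * f x) ≡ c * sumBy xs f
sumBy-*ˡ []       c f = sym (*-zeroʳ c)
sumBy-*ˡ (x ∷ xs) c f = trans (cong (c * f x +_) (sumBy-*ˡ xs c f))
                              (sym (*-distribˡ-+ c (f x) (sumBy xs f)))

sumBy-++ : ∀ (xs ys : List X) (f : X → ℕ) → sumBy (xs ++ ys) f ≡ sumBy xs f + sumBy ys f
sumBy-++ []       ys f = refl
sumBy-++ (x ∷ xs) ys f = trans (cong (f x +_) (sumBy-++ xs ys f)) (sym (+-assoc (f x) _ _))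

sumBy-map : (xs : List X) (h : X → Y) (f : Y → ℕ) →
  sumBy (map h xs) f ≡ sumBy xs (λ x → f (h x))
sumBy-map []       h f = refl
sumBy-map (x ∷ xs) h f = cong (f (h x) +_) (sumBy-map xs h f)

sumBy-concatMap : (xs : List X) (h : X → List Y) (f : Y → ℕ) →
  sumBy (concatMap h xs) f ≡ sumBy xs (λ x → sumBy (h x) f)
sumBy-concatMap []       h f = refl
sumBy-concatMap (x ∷ xs) h f =
  trans (sumBy-++ (h x) (concatMap h xs) f) (cong (sumBy (h x) f +_) (sumBy-concatMap xs h f))

sum-map≡sumBy : ∀ (xs : List X) (f : X → ℕ) → sum (map f xs) ≡ sumBy xs f
sum-map≡sumBy []       f = refl
sum-map≡sumBy (x ∷ xs) f = cong (f x +_) (sum-map≡sumBy xs f)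

Σ< : ℕ → (ℕ → ℕ) → ℕ
Σ< zero    f = 0
Σ< (suc n) f = f 0 + Σ< n (λ x → f (suc x))

sumBy-applyUpTo : ∀ n (h f : ℕ → ℕ) → sumBy (applyUpTo h n) f ≡ Σ< n (λ x → f (h x))
sumBy-applyUpTo zero    h f = refl
sumBy-applyUpTo (suc n) h f = cong (f (h 0) +_) (sumBy-applyUpTo n (λ x → h (suc x)) f)

Σ≤≡Σ< : ∀ n f → Σ≤ n f ≡ Σ< (suc n) f
Σ≤≡Σ< n f = trans (sum-map≡sumBy (upTo (suc n)) f) (sumBy-applyUpTo (suc n) (λ x → x) f)

Σ<-cong : ∀ n {f g : ℕ → ℕ} → (∀ x → x < n → f x ≡ g x) → Σ< n f ≡ Σ< n g
Σ<-cong zero    f≗g = refl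
Σ<-cong (suc n) f≗g = cong₂ _+_ (f≗g 0 z<s) (Σ<-cong n (λ x x<n → f≗g (suc x) (s<s x<n)))

Σ<-zero : ∀ n {f : ℕ → ℕ} → (∀ x → x < n → f x ≡ 0) → Σ< n f ≡ 0
Σ<-zero zero    f≗0 = refl
Σ<-zero (suc n) f≗0 = cong₂ _+_ (f≗0 0 z<s) (Σ<-zero n (λ x x<n → f≗0 (suc x) (s<s x<n)))

Σ<-+ : ∀ n (f g : ℕ → ℕ) → Σ< n (λ x → f x + g x) ≡ Σ< n f + Σ< n g
Σ<-+ zero    f g = refl
Σ<-+ (suc n) f g = trans (cong (f 0 + g 0 +_) (Σ<-+ n _ _)) (interchange (f 0) (g 0) _ _)

Σ<-split : ∀ m n f → Σ< (m + n) f ≡ Σ< m f + Σ< n (λ x → f (m + x))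
Σ<-split zero    n f = refl
Σ<-split (suc m) n f = trans (cong (f 0 +_) (Σ<-split m n (λ x → f (suc x)))) (sym (+-assoc (f 0) _ _))

Σ<-extend : ∀ m n f → (∀ x → m ≤ x → f x ≡ 0) → Σ< (m + n) f ≡ Σ< m f
Σ<-extend m n f f≗0 = begin
  Σ< (m + n) f
    ≡⟨ Σ<-split m n f ⟩
  Σ< m f + Σ< n (λ x → f (m + x))
    ≡⟨ cong (Σ< m f +_) (Σ<-zero n (λ x _ → f≗0 (m + x) (m≤m+n m x))) ⟩
  Σ< m f + 0
    ≡⟨ +-identityʳ _ ⟩
  Σ< m f ∎
  where open ≡-Reasoning

Σ<-support : ∀ m n f → (∀ x → m ≤ x → f x ≡ 0) → (∀ x → n ≤ x → f x ≡ 0) →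
  Σ< m f ≡ Σ< n f
Σ<-support m n f ≥m⇒0 ≥n⇒0 = begin
  Σ< m f       ≡⟨ Σ<-extend m n f ≥m⇒0 ⟨
  Σ< (m + n) f ≡⟨ cong (λ l → Σ< l f) (+-comm m n) ⟩
  Σ< (n + m) f ≡⟨ Σ<-extend n m f ≥n⇒0 ⟩
  Σ< n f       ∎
  where open ≡-Reasoning

Σ<-blocks : ∀ n b f → Σ< (n * b) f ≡ Σ< n (λ i → Σ< b (λ j → f (b * i + j)))
Σ<-blocks zero    b f = refl
Σ<-blocks (suc n) b f = begin
  Σ< (b + n * b) f
    ≡⟨ Σ<-split b (n * b) f ⟩
  Σ< b f + Σ< (n * b) (λ x → f (b + x))
    ≡⟨ cong₂ _+_ (Σ<-cong b (λ j _ → cong (λ z → f (z + j)) (sym (*-zeroʳ b))))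
                 (Σ<-blocks n b (λ x → f (b + x))) ⟩
  Σ< b (λ j → f (b * 0 + j)) + Σ< n (λ i → Σ< b (λ j → f (b + (b * i + j))))
    ≡⟨ cong (Σ< b (λ j → f (b * 0 + j)) +_)
            (Σ<-cong n (λ i _ → Σ<-cong b (λ j _ → cong f (block-start b i j)))) ⟩
  Σ< (suc n) (λ i → Σ< b (λ j → f (b * i + j))) ∎
  where
  open ≡-Reasoning
  block-start : ∀ b i j → b + (b * i + j) ≡ b * suc i + j
  block-start = solve-∀

sumBy-Σ< : ∀ (xs : List X) n (f : ℕ → X → ℕ) →
  sumBy xs (λ a → Σ< n (λ x → f x a)) ≡ Σ< n (λ x → sumBy xs (f x))
sumBy-Σ< xs zero    f = sumBy-zero xs (λ _ → refl)
sumBy-Σ< xs (suc n) f = trans (sumBy-+ xs (f 0) (λ a → Σ< n (λ x → f (suc x) a)))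
                              (cong (sumBy xs (f 0) +_) (sumBy-Σ< xs n (λ x → f (suc x))))

ΣTuples : (k M : ℕ) → (Vec ℕ k → ℕ) → ℕ
ΣTuples k M f = sumBy (tuples k M) f

ΣTuples-cong : ∀ k M {f g : Vec ℕ k → ℕ} → (∀ v → f v ≡ g v) →
  ΣTuples k M f ≡ ΣTuples k M g
ΣTuples-cong k M = sumBy-cong (tuples k M)

ΣTuples-suc : ∀ k M f → ΣTuples (suc k) M f ≡ Σ< (suc M) (λ x → ΣTuples k M (λ v → f (x ∷ v)))
ΣTuples-suc k M f = begin
  sumBy (concatMap (λ x → map (x ∷_) (tuples k M)) (upTo (suc M))) f
    ≡⟨ sumBy-concatMap (upTo (suc M)) (λ x → map (x ∷_) (tuples k M)) f ⟩
  sumBy (upTo (suc M)) (λ x → sumBy (map (x ∷_) (tuples k M)) f)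
    ≡⟨ sumBy-cong (upTo (suc M)) (λ x → sumBy-map (tuples k M) (x ∷_) f) ⟩
  sumBy (upTo (suc M)) (λ x → ΣTuples k M (λ v → f (x ∷ v)))
    ≡⟨ sumBy-applyUpTo (suc M) (λ x → x) _ ⟩
  Σ< (suc M) (λ x → ΣTuples k M (λ v → f (x ∷ v))) ∎
  where open ≡-Reasoning

ΣTuples-extend : ∀ k {M M'} f → M ≤ M' → (∀ v → M < total v → f v ≡ 0) →
  ΣTuples k M f ≡ ΣTuples k M' f
ΣTuples-extend zero    f M≤M' f≗0 = refl
ΣTuples-extend (suc k) {M} {M'} f M≤M' f≗0 = begin
  ΣTuples (suc k) M f
    ≡⟨ ΣTuples-suc k M f ⟩
  Σ< (suc M) (λ x → ΣTuples k M (λ v → f (x ∷ v)))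
    ≡⟨ Σ<-cong (suc M) (λ x _ → ΣTuples-extend k (λ v → f (x ∷ v)) M≤M'
                                  (λ v M<v → f≗0 (x ∷ v) (<-≤-trans M<v (m≤n+m (total v) x)))) ⟩
  Σ< (suc M) G
    ≡⟨ Σ<-support (suc M) (suc M') G G≗0 (λ x M'<x → G≗0 x (≤-trans (s≤s M≤M') M'<x)) ⟩
  Σ< (suc M') G
    ≡⟨ ΣTuples-suc k M' f ⟨
  ΣTuples (suc k) M' f ∎
  where
  open ≡-Reasoning
  G : ℕ → ℕ
  G x = ΣTuples k M' (λ v → f (x ∷ v))
  G≗0 : ∀ x → suc M ≤ x → G x ≡ 0
  G≗0 x M<x = sumBy-zero (tuples k M') (λ v → f≗0 (x ∷ v) (≤-trans M<x (m≤m+n x (total v))))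

ΣBits : (k : ℕ) → (Vec Bool k → ℕ) → ℕ
ΣBits zero    h = h []
ΣBits (suc k) h = ΣBits k (λ bs → h (false ∷ bs)) + ΣBits k (λ bs → h (true ∷ bs))

ΣBits-cong : ∀ k {g h : Vec Bool k → ℕ} → (∀ b → g b ≡ h b) → ΣBits k g ≡ ΣBits k h
ΣBits-cong zero    g≗h = g≗h []
ΣBits-cong (suc k) g≗h = cong₂ _+_ (ΣBits-cong k (λ b → g≗h (false ∷ b)))
                                   (ΣBits-cong k (λ b → g≗h (true ∷ b)))

ΣTuples-halves : ∀ k m f →
  ΣTuples k (suc (2 * m)) f ≡ ΣTuples k m (λ q → ΣBits k (λ b → f (assemble q b)))
ΣTuples-halves zero    m f = refl
ΣTuples-halves (suc k) m f = begin
  ΣTuples (suc k) (suc (2 * m)) f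
    ≡⟨ ΣTuples-suc k (suc (2 * m)) f ⟩
  Σ< (2 + 2 * m) G
    ≡⟨ cong (λ l → Σ< (2 + l) G) (*-comm 2 m) ⟩
  Σ< (suc m * 2) G
    ≡⟨ Σ<-blocks (suc m) 2 G ⟩
  Σ< (suc m) (λ q → G (2 * q + 0) + (G (2 * q + 1) + 0))
    ≡⟨ Σ<-cong (suc m) (λ q _ →
         cong₂ _+_ (ΣTuples-halves k m (λ v → f ((2 * q + 0) ∷ v)))
                   (trans (+-identityʳ _) (ΣTuples-halves k m (λ v → f ((2 * q + 1) ∷ v))))) ⟩
  Σ< (suc m) (λ q → ΣTuples k m (H 0 q) + ΣTuples k m (H 1 q))
    ≡⟨ Σ<-cong (suc m) (λ q _ → sumBy-+ (tuples k m) (H 0 q) (H 1 q)) ⟨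
  Σ< (suc m) (λ q → ΣTuples k m (λ qs → ΣBits (suc k) (λ b → f (assemble (q ∷ qs) b))))
    ≡⟨ ΣTuples-suc k m _ ⟨
  ΣTuples (suc k) m (λ q → ΣBits (suc k) (λ b → f (assemble q b))) ∎
  where
  open ≡-Reasoning
  H : ℕ → ℕ → Vec ℕ k → ℕ
  H c q qs = ΣBits k (λ bs → f ((2 * q + c) ∷ assemble qs bs))
  G : ℕ → ℕ
  G x = ΣTuples k (suc (2 * m)) (λ v → f (x ∷ v))

Σ<-binomial-suc : ∀ k (g : ℕ → ℕ) →
  Σ< (suc k) (λ w → (k C w) * g w) + Σ< (suc k) (λ w → (k C w) * g (suc w))
    ≡ Σ< (suc (suc k)) (λ w → (suc k C w) * g w)
Σ<-binomial-suc k g = begin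
  (g 0 + 0 + T) + S
    ≡⟨ xy∙z≈x∙zy (g 0 + 0) T S ⟩
  g 0 + 0 + (S + T)
    ≡⟨ cong (λ z → g 0 + 0 + (S + z))
            (Σ<-support k (suc k) _ C[k,1+w]≗0 (λ w k<w → C[k,1+w]≗0 w (<⇒≤ k<w))) ⟩
  g 0 + 0 + (S + Σ< (suc k) (λ w → (k C suc w) * g (suc w)))
    ≡⟨ cong (g 0 + 0 +_) (Σ<-+ (suc k) (λ w → (k C w) * g (suc w))
                                       (λ w → (k C suc w) * g (suc w))) ⟨
  g 0 + 0 + Σ< (suc k) (λ w → (k C w) * g (suc w) + (k C suc w) * g (suc w))
    ≡⟨ cong (g 0 + 0 +_) (Σ<-cong (suc k) (λ w _ → pascal w)) ⟩
  g 0 + 0 + Σ< (suc k) (λ w → (suc k C suc w) * g (suc w)) ∎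
  where
  open ≡-Reasoning
  S = Σ< (suc k) (λ w → (k C w) * g (suc w))
  T = Σ< k (λ w → (k C suc w) * g (suc w))
  C[k,1+w]≗0 : ∀ w → k ≤ w → (k C suc w) * g (suc w) ≡ 0
  C[k,1+w]≗0 w k≤w = cong (_* g (suc w)) (k>n⇒nCk≡0 (s≤s k≤w))
  pascal : ∀ w → (k C w) * g (suc w) + (k C suc w) * g (suc w) ≡ (suc k C suc w) * g (suc w)
  pascal w = trans (sym (*-distribʳ-+ (g (suc w)) (k C w) (k C suc w)))
                   (cong (_* g (suc w)) (nCk+nC[k+1]≡[n+1]C[k+1] k w))

ΣBits-popcount : ∀ k (g : ℕ → ℕ) →
  ΣBits k (λ b → g (popcount b)) ≡ Σ< (suc k) (λ w → (k C w) * g w)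
ΣBits-popcount zero    g = sym (trans (+-identityʳ _) (+-identityʳ _))
ΣBits-popcount (suc k) g = trans (cong₂ _+_ (ΣBits-popcount k g) (ΣBits-popcount k (λ w → g (suc w))))
                                 (Σ<-binomial-suc k g)

length-filter≡sumBy : ∀ (p : X → Bool) xs →
  length (filter (λ x → p x Bool.≟ true) xs) ≡ sumBy xs (λ x → bit (p x))
length-filter≡sumBy p []       = refl
length-filter≡sumBy p (x ∷ xs) with p x
... | true  = cong suc (length-filter≡sumBy p xs)
... | false = length-filter≡sumBy p xs

P : ∀ {k} → ℕ → Vec ℕ k → ℕ
P t v = bit (isP≤ t v)

A≡ΣTuples : ∀ k n → A k n ≡ ΣTuples k (2 * n) (P (2 * n))
A≡ΣTuples k n = length-filter≡sumBy (isP≤ (2 * n)) (tuples k (2 * n))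

P-big : ∀ {k} t (v : Vec ℕ k) → t < total v → P t v ≡ 0
P-big t v t<v = cong bit (trans (cong ((nimSum v ≡ᵇ 0) ∧_) (dec-false (total v ≤? t) (<⇒≱ t<v)))
                               (∧-zeroʳ _))

P-lift : ∀ {k} → ℕ → ℕ → Vec ℕ k → ℕ
P-lift t w q = bit (((w % 2 + 2 * nimSum q) ≡ᵇ 0) ∧ (w + 2 * total q ≤ᵇ t))

P-assemble : ∀ {k} t (q : Vec ℕ k) b → P t (assemble q b) ≡ P-lift t (popcount b) q
P-assemble t q b = cong bit (cong₂ _∧_ (cong (_≡ᵇ 0) (nimSum-assemble q b))
                                       (cong (_≤ᵇ t) (total-assemble q b)))

liftCount : (k m t w : ℕ) → ℕ
liftCount k m t w = ΣTuples k m (P-lift t w)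

ΣTuples-P-binomial : ∀ k m t → t ≤ suc (2 * m) →
  ΣTuples k t (P t) ≡ Σ< (suc k) (λ w → (k C w) * liftCount k m t w)
ΣTuples-P-binomial k m t t≤ = begin
  ΣTuples k t (P t)
    ≡⟨ ΣTuples-extend k (P t) t≤ (P-big t) ⟩
  ΣTuples k (suc (2 * m)) (P t)
    ≡⟨ ΣTuples-halves k m (P t) ⟩
  ΣTuples k m (λ q → ΣBits k (λ b → P t (assemble q b)))
    ≡⟨ ΣTuples-cong k m (λ q → trans (ΣBits-cong k (P-assemble t q))
                                     (ΣBits-popcount k (λ w → P-lift t w q))) ⟩
  ΣTuples k m (λ q → Σ< (suc k) (λ w → (k C w) * P-lift t w q))
    ≡⟨ sumBy-Σ< (tuples k m) (suc k) (λ w q → (k C w) * P-lift t w q) ⟩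
  Σ< (suc k) (λ w → ΣTuples k m (λ q → (k C w) * P-lift t w q))
    ≡⟨ Σ<-cong (suc k) (λ w _ → sumBy-*ˡ (tuples k m) (k C w) (P-lift t w)) ⟩
  Σ< (suc k) (λ w → (k C w) * liftCount k m t w) ∎
  where open ≡-Reasoning

liftCount-large : ∀ k m {t w} → t < w → liftCount k m t w ≡ 0
liftCount-large k m {t} {w} t<w = sumBy-zero (tuples k m) (λ q →
  cong bit (trans (cong (((w % 2 + 2 * nimSum q) ≡ᵇ 0) ∧_)
                        (dec-false (w + 2 * total q ≤? t)
                                   (λ fits → <⇒≱ t<w (≤-trans (m≤m+n w _) fits))))
                  (∧-zeroʳ _)))

liftCount-odd : ∀ k m t {w} j → w ≡ suc (2 * j) → liftCount k m t w ≡ 0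
liftCount-odd k m t j refl = sumBy-zero (tuples k m) (λ q →
  cong (λ c → bit (((c + 2 * nimSum q) ≡ᵇ 0) ∧ (suc (2 * j) + 2 * total q ≤ᵇ t))) [1+2j]%2≡1)
  where
  [1+2j]%2≡1 : suc (2 * j) % 2 ≡ 1
  [1+2j]%2≡1 = trans (cong (_% 2) (+-comm 1 (2 * j))) ([2m+c]%2≡c j (s≤s z≤n))

4u≤4s+r⇔u≤s : ∀ u s {r} → r < 4 → (4 * u ≤ 4 * s + r) ⇔ (u ≤ s)
4u≤4s+r⇔u≤s u s {r} r<4 = mk⇔
  (λ 4u≤ → ≤-pred (*-cancelˡ-< 4 u (suc s) (begin-strict
    4 * u     ≤⟨ 4u≤ ⟩
    4 * s + r <⟨ +-monoʳ-< (4 * s) r<4 ⟩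
    4 * s + 4 ≡⟨ +-comm (4 * s) 4 ⟩
    4 + 4 * s ≡⟨ *-suc 4 s ⟨
    4 * suc s ∎)))
  (λ u≤s → ≤-trans (*-monoʳ-≤ 4 u≤s) (m≤m+n (4 * s) r))
  where open ≤-Reasoning

2u-fits : ∀ a s {x} u {r} → x ≡ 2 * u → r < 4 → (a + 2 * x ≤ a + (4 * s + r)) ⇔ (x ≤ 2 * s)
2u-fits a s u {r} refl r<4 = mk⇔
  (λ fits → *-monoʳ-≤ 2 (Equivalence.to (4u≤4s+r⇔u≤s u s r<4)
                           (subst (_≤ 4 * s + r) (2[2u]≡4u u) (+-cancelˡ-≤ a _ _ fits))))
  (λ 2u≤2s → +-monoʳ-≤ a (subst (_≤ 4 * s + r) (sym (2[2u]≡4u u))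
                           (Equivalence.from (4u≤4s+r⇔u≤s u s r<4) (*-cancelˡ-≤ 2 2u≤2s))))
  where
  2[2u]≡4u : ∀ u → 2 * (2 * u) ≡ 4 * u
  2[2u]≡4u = solve-∀

-- A P-position has even total, because nim-sum and total have the same parity.
P-lift-even : ∀ {k} j s {r} → r < 4 → (q : Vec ℕ k) →
  P-lift (2 * j + (4 * s + r)) (2 * j) q ≡ P (2 * s) q
P-lift-even j s {r} r<4 q rewrite [2m]%2≡0 j with nimSum q in N≡
... | suc _ = refl
... | zero  = cong bit (does-⇔ (2u-fits (2 * j) s (total q / 2) total≡2u r<4)
                                (2 * j + 2 * total q ≤? 2 * j + (4 * s + r)) (total q ≤? 2 * s))
  where
  total%2≡0 : total q % 2 ≡ 0
  total%2≡0 = trans (sym (nimSum%2≡total%2 q)) (cong (_% 2) N≡)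
  total≡2u : total q ≡ 2 * (total q / 2)
  total≡2u = trans (m≡2[m/2]+m%2 (total q))
                   (trans (cong (2 * (total q / 2) +_) total%2≡0) (+-identityʳ _))

liftCount-even : ∀ k m {t w} j s {r} → w ≡ 2 * j → t ≡ w + (4 * s + r) → r < 4 → 2 * s ≤ m →
  liftCount k m t w ≡ A k s
liftCount-even k m j s refl refl r<4 2s≤m = begin
  ΣTuples k m (P-lift _ (2 * j)) ≡⟨ ΣTuples-cong k m (P-lift-even j s r<4) ⟩
  ΣTuples k m (P (2 * s))        ≡⟨ ΣTuples-extend k (P (2 * s)) 2s≤m (P-big (2 * s)) ⟨
  ΣTuples k (2 * s) (P (2 * s))  ≡⟨ A≡ΣTuples k s ⟨
  A k s                          ∎
  where open ≡-Reasoning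

weighted : (k m t w : ℕ) → ℕ
weighted k m t w = (k C w) * liftCount k m t w

weighted-odd : ∀ k m t {w} j → w ≡ suc (2 * j) → weighted k m t w ≡ 0
weighted-odd k m t {w} j w≡ = trans (cong ((k C w) *_) (liftCount-odd k m t j w≡)) (*-zeroʳ (k C w))

weighted-even : ∀ k m {t w} j s {r} → w ≡ 2 * j → t ≡ w + (4 * s + r) → r < 4 → 2 * s ≤ m →
  weighted k m t w ≡ (k C w) * A k s
weighted-even k m {w = w} j s w≡ t≡ r<4 2s≤m =
  cong ((k C w) *_) (liftCount-even k m j s w≡ t≡ r<4 2s≤m)

A-expansion : ∀ k m n N → 2 * n ≤ suc (2 * m) → 2 * n < N → A k n ≡ Σ< N (weighted k m (2 * n))
A-expansion k m n N t≤ t<N = begin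
  A k n                                 ≡⟨ A≡ΣTuples k n ⟩
  ΣTuples k (2 * n) (P (2 * n))         ≡⟨ ΣTuples-P-binomial k m (2 * n) t≤ ⟩
  Σ< (suc k) (weighted k m (2 * n))     ≡⟨ Σ<-support (suc k) N (weighted k m (2 * n)) C≗0 L≗0 ⟩
  Σ< N (weighted k m (2 * n))           ∎
  where
  open ≡-Reasoning
  C≗0 : ∀ w → suc k ≤ w → weighted k m (2 * n) w ≡ 0
  C≗0 w k<w = cong (_* liftCount k m (2 * n) w) (k>n⇒nCk≡0 k<w)
  L≗0 : ∀ w → N ≤ w → weighted k m (2 * n) w ≡ 0
  L≗0 w N≤w = trans (cong ((k C w) *_) (liftCount-large k m (<-≤-trans t<N N≤w))) (*-zeroʳ (k C w))

odd-block : ∀ k {n} i s → i + s ≡ n →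
  Σ< 4 (λ j → weighted k (2 * n + 1) (2 * (2 * n + 1)) (4 * i + j))
    ≡ ((k C (4 * i + 2)) + (k C (4 * i))) * A k s
odd-block k i s refl = begin
  Σ< 4 (λ j → weighted k m t (4 * i + j))
    ≡⟨ cong₂ _+_ (weighted-even k m (2 * i) s (e₀ i) (t₀ i s) (s<s (s<s z<s)) 2s≤m)
        (cong₂ _+_ (weighted-odd k m t (2 * i) (o₁ i))
          (cong₂ _+_ (weighted-even k m (2 * i + 1) s (e₂ i) (t₂ i s) z<s 2s≤m)
            (cong (_+ 0) (weighted-odd k m t (2 * i + 1) (o₃ i))))) ⟩
  (k C (4 * i + 0)) * A k s + (0 + ((k C (4 * i + 2)) * A k s + (0 + 0)))
    ≡⟨ cong (λ w → (k C w) * A k s + (0 + ((k C (4 * i + 2)) * A k s + (0 + 0))))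
            (+-identityʳ (4 * i)) ⟩
  (k C (4 * i)) * A k s + (0 + ((k C (4 * i + 2)) * A k s + (0 + 0)))
    ≡⟨ collect (k C (4 * i)) (k C (4 * i + 2)) (A k s) ⟩
  ((k C (4 * i + 2)) + (k C (4 * i))) * A k s ∎
  where
  open ≡-Reasoning
  m = 2 * (i + s) + 1
  t = 2 * m
  2s≤m : 2 * s ≤ m
  2s≤m = ≤-trans (*-monoʳ-≤ 2 (m≤n+m s i)) (m≤m+n _ 1)
  e₀ : ∀ i → 4 * i + 0 ≡ 2 * (2 * i)
  e₀ = solve-∀
  o₁ : ∀ i → 4 * i + 1 ≡ suc (2 * (2 * i))
  o₁ = solve-∀
  e₂ : ∀ i → 4 * i + 2 ≡ 2 * (2 * i + 1)
  e₂ = solve-∀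
  o₃ : ∀ i → 4 * i + 3 ≡ suc (2 * (2 * i + 1))
  o₃ = solve-∀
  t₀ : ∀ i s → 2 * (2 * (i + s) + 1) ≡ 4 * i + 0 + (4 * s + 2)
  t₀ = solve-∀
  t₂ : ∀ i s → 2 * (2 * (i + s) + 1) ≡ 4 * i + 2 + (4 * s + 0)
  t₂ = solve-∀
  collect : ∀ a b x → a * x + (0 + (b * x + (0 + 0))) ≡ (b + a) * x
  collect = solve-∀

even-block : ∀ k {n} i s → i + s ≡ n →
  Σ< 4 (λ j → weighted k (2 * n + 2) (2 * (2 * n + 2)) (suc (4 * i + j)))
    ≡ ((k C (4 * i + 2)) + (k C (4 * i + 4))) * A k s
even-block k i s refl = begin
  Σ< 4 (λ j → weighted k m t (suc (4 * i + j)))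
    ≡⟨ cong₂ _+_ (weighted-odd k m t (2 * i) (o₀ i))
        (cong₂ _+_ (weighted-even k m (2 * i + 1) s (e₁ i) (t₁ i s) (s<s (s<s z<s)) 2s≤m)
          (cong₂ _+_ (weighted-odd k m t (2 * i + 1) (o₂ i))
            (cong (_+ 0) (weighted-even k m (2 * i + 2) s (e₃ i) (t₃ i s) z<s 2s≤m)))) ⟩
  0 + ((k C suc (4 * i + 1)) * A k s + (0 + ((k C suc (4 * i + 3)) * A k s + 0)))
    ≡⟨ cong₂ (λ w w' → 0 + ((k C w) * A k s + (0 + ((k C w') * A k s + 0))))
             (sym (+-suc (4 * i) 1)) (sym (+-suc (4 * i) 3)) ⟩
  0 + ((k C (4 * i + 2)) * A k s + (0 + ((k C (4 * i + 4)) * A k s + 0)))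
    ≡⟨ collect (k C (4 * i + 2)) (k C (4 * i + 4)) (A k s) ⟩
  ((k C (4 * i + 2)) + (k C (4 * i + 4))) * A k s ∎
  where
  open ≡-Reasoning
  m = 2 * (i + s) + 2
  t = 2 * m
  2s≤m : 2 * s ≤ m
  2s≤m = ≤-trans (*-monoʳ-≤ 2 (m≤n+m s i)) (m≤m+n _ 2)
  o₀ : ∀ i → suc (4 * i + 0) ≡ suc (2 * (2 * i))
  o₀ = solve-∀
  e₁ : ∀ i → suc (4 * i + 1) ≡ 2 * (2 * i + 1)
  e₁ = solve-∀
  o₂ : ∀ i → suc (4 * i + 2) ≡ suc (2 * (2 * i + 1))
  o₂ = solve-∀
  e₃ : ∀ i → suc (4 * i + 3) ≡ 2 * (2 * i + 2)
  e₃ = solve-∀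
  t₁ : ∀ i s → 2 * (2 * (i + s) + 2) ≡ suc (4 * i + 1) + (4 * s + 2)
  t₁ = solve-∀
  t₃ : ∀ i s → 2 * (2 * (i + s) + 2) ≡ suc (4 * i + 3) + (4 * s + 0)
  t₃ = solve-∀
  collect : ∀ a b x → 0 + (a * x + (0 + (b * x + 0))) ≡ (a + b) * x
  collect = solve-∀

A-odd : ∀ k n → A k (2 * n + 1) ≡ Σ≤ n (λ i → ((k C (4 * i + 2)) + (k C (4 * i))) * A k (n ∸ i))
A-odd k n = begin
  A k (2 * n + 1)
    ≡⟨ A-expansion k (2 * n + 1) (2 * n + 1) (suc n * 4) (n≤1+n _) t<N ⟩
  Σ< (suc n * 4) (weighted k m t)
    ≡⟨ Σ<-blocks (suc n) 4 (weighted k m t) ⟩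
  Σ< (suc n) (λ i → Σ< 4 (λ j → weighted k m t (4 * i + j)))
    ≡⟨ Σ<-cong (suc n) (λ i i≤n → odd-block k i (n ∸ i) (m+[n∸m]≡n (≤-pred i≤n))) ⟩
  Σ< (suc n) (λ i → ((k C (4 * i + 2)) + (k C (4 * i))) * A k (n ∸ i))
    ≡⟨ Σ≤≡Σ< n _ ⟨
  Σ≤ n (λ i → ((k C (4 * i + 2)) + (k C (4 * i))) * A k (n ∸ i)) ∎
  where
  open ≡-Reasoning
  m = 2 * n + 1
  t = 2 * m
  t<N : t < suc n * 4
  t<N = subst (t <_) (t+2≡ n) (m<m+n t z<s)
    where
    t+2≡ : ∀ n → 2 * (2 * n + 1) + 2 ≡ suc n * 4
    t+2≡ = solve-∀

A-even : ∀ k n → A k (2 * n + 2) ≡ (k C 0) * A k (n + 1)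
           + Σ≤ n (λ i → ((k C (4 * i + 2)) + (k C (4 * i + 4))) * A k (n ∸ i))
A-even k n = begin
  A k (2 * n + 2)
    ≡⟨ A-expansion k (2 * n + 2) (2 * n + 2) (suc (suc n * 4)) (n≤1+n _) t<N ⟩
  weighted k m t 0 + Σ< (suc n * 4) (λ w → weighted k m t (suc w))
    ≡⟨ cong₂ _+_ (weighted-even k m 0 (n + 1) refl (t≡ n) z<s (≤-reflexive (2[n+1]≡ n)))
                 (Σ<-blocks (suc n) 4 (λ w → weighted k m t (suc w))) ⟩
  (k C 0) * A k (n + 1) + Σ< (suc n) (λ i → Σ< 4 (λ j → weighted k m t (suc (4 * i + j))))
    ≡⟨ cong ((k C 0) * A k (n + 1) +_)
            (Σ<-cong (suc n) (λ i i≤n → even-block k i (n ∸ i) (m+[n∸m]≡n (≤-pred i≤n)))) ⟩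
  (k C 0) * A k (n + 1) + Σ< (suc n) (λ i → ((k C (4 * i + 2)) + (k C (4 * i + 4))) * A k (n ∸ i))
    ≡⟨ cong ((k C 0) * A k (n + 1) +_) (Σ≤≡Σ< n _) ⟨
  (k C 0) * A k (n + 1) + Σ≤ n (λ i → ((k C (4 * i + 2)) + (k C (4 * i + 4))) * A k (n ∸ i)) ∎
  where
  open ≡-Reasoning
  m = 2 * n + 2
  t = 2 * m
  t≡ : ∀ n → 2 * (2 * n + 2) ≡ 0 + (4 * (n + 1) + 0)
  t≡ = solve-∀
  2[n+1]≡ : ∀ n → 2 * (n + 1) ≡ 2 * n + 2
  2[n+1]≡ = solve-∀
  t<N : t < suc (suc n * 4)
  t<N = s≤s (≤-reflexive (t≡N n))
    where
    t≡N : ∀ n → 2 * (2 * n + 2) ≡ suc n * 4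
    t≡N = solve-∀

theorem30 : (k : ℕ) → k ≥ 1 → (n : ℕ) →
    (A k (2 * n + 1) ≡ Σ≤ n (λ i → ((k C (4 * i + 2)) + (k C (4 * i))) * A k (n ∸ i)))
    × (A k (2 * n + 2) ≡ (k C 0) * A k (n + 1)
         + Σ≤ n (λ i → ((k C (4 * i + 2)) + (k C (4 * i + 4))) * A k (n ∸ i)))
theorem30 k _ n = A-odd k n , A-even k n
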